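{- Let $\tau=(\tau_1,\dots,\tau_\ell)\in\mathbb{Z}_{>0}^\ell$, $0\le k\le\ell-1$, and let $\hat P_\tau=C\sqcup O$ be the $k$-decomposition. Consider two maximal chains $\mathbf p=\{\hat0,p_1,\dots,p_k,a\}$ and $\mathbf p'=\{\hat0,p'_1,\dots,p'_k,a'\}$ with $p_i,p'_i\in Y^i$ and $a,a'\in Y^{k+1}$, and set $p_{k+1}:=a$, $p'_{k+1}:=a'$. Let $F$ be the face of $\mathcal{O}_{C,O}(\tau)$ on which both chain equalities $x_{p_1}+\dots+x_{p_k}=x_a$ and $x_{p'_1}+\dots+x_{p'_k}=x_{a'}$ hold. Let $I=\{i\in\{1,\dots,k+1\}: p_i\ne p'_i\}$ and $\tau'=(\tau'_1,\dots,\tau'_\ell)$ with $\tau'_j=\tau_j-1$ if $j\in I$ and $\tau'_j=\tau_j$ otherwise; identify $\hat P_{\tau'}$ with $\hat P_\tau\setminus(\mathbf p'\setminus\mathbf p)$, with its $k$-decomposition $C'\sqcup O'$. Then the coordinate projection forgetting the coordinates indexed by $\mathbf p'\setminus\mathbf p$ is an affine isomorphism $$\nu: F\to F',\qquad (x_p)_{p\in\hat P_\tau}\mapsto (x_{p})_{p\in\hat P_{\tau'}},$$ where $F'$ is the face of $\mathcal{O}_{C',O'}(\tau')$ given by the equation $x_{p_1}+\dots+x_{p_k}=x_a$ of $\mathbf p$. Moreover, each coordinate projected away contributes exactly one additional codimension, i.e. the codimension of $F$ in $\mathcal{O}_{C,O}(\tau)$ equals the codimension of $F'$ in $\mathcal{O}_{C',O'}(\tau')$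 plus $|I|$.
   Context: For $\tau=(\tau_1,\dots,\tau_\ell)$ a tuple of positive integers, $P_\tau$ is the poset with ranks $Y^1,\dots,Y^\ell$, $|Y^i|=\tau_i$, and $y<z$ for $y\in Y^i,z\in Y^j$ iff $i<j$; $\hat P_\tau$ adds a minimum $\hat0$ and maximum $\hat1$, with $Y^0=\{\hat0\}$, $Y^{\ell+1}=\{\hat1\}$; covering relations are the pairs $p\in Y^i$, $q\in Y^{i+1}$. The $k$-decomposition is $C=\bigcup_{i=0}^kY^i$, $O=\bigcup_{i=k+1}^{\ell+1}Y^i$. The chain-order polytope $\mathcal{O}_{C,O}(\tau)\subseteq\mathbb{R}^{\hat P_\tau}$ is defined by $x_{\hat0}=0$, $x_{\hat1}=1$, $0\le x_p$ for $p\in C$, the order inequalities $x_a\le x_b$ for covering relations $a\prec b$ with $a,b\in O$, and the chain inequalities $x_{p_1}+\dots+x_{p_k}\le x_q$ for all $p_i\in Y^i$ ($1\le i\le k$), $q\in Y^{k+1}$. Codimension of a face is the dimension of the polytope minus that of the face.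
   Formalization: The polytopes $\mathcal{O}_{C,O}(\tau)$ and $\mathcal{O}_{C',O'}(\tau')$ and the faces F and F′ consist of points with rational coordinates instead of points of $\mathbb{R}^{\hat P_\tau}$. -}

module Defs where

open import Data.Nat using (ℕ; zero; suc; pred; _<_; _≤_; _<?_; _+_)
open import Data.Nat.Properties using (m<n⇒m<1+n; ≤-refl)
open import Data.Fin using (Fin; punchIn) renaming (_≟_ to _≟F_)
open import Data.List using (List; []; _∷_)
open import Data.Maybe using (Maybe; just; nothing)
open import Data.Product using (Σ; _×_; _,_)
open import Relation.Nullary using (¬_; yes; no)
open import Relation.Nullary.Decidable using (isYes)
open import Data.Bool using (Bool; true; false; if_then_else_; not)
open import Relation.Binary.PropositionalEquality using (_≡_)
open import Data.Rational using (ℚ; 0ℚ; 1ℚ) renaming (_+_ to _+ℚ_; _*_ to _*ℚ_; _≤_ to _≤ℚ_)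

-- Rank sizes of the poset  P̂_τ : rank 0 = {0̂}, rank i = Y^i (|Y^i| = τ_i)
-- for 1 ≤ i ≤ ℓ, rank ℓ+1 = {1̂}, and empty ranks beyond.

sizeL : List ℕ → ℕ → ℕ
sizeL []       zero    = 1
sizeL []       (suc _) = 0
sizeL (t ∷ ts) zero    = t
sizeL (t ∷ ts) (suc i) = sizeL ts i

sizeOf : List ℕ → ℕ → ℕ
sizeOf τ zero    = 1
sizeOf τ (suc i) = sizeL τ i

-- An element of P̂ is a pair (rank i, j : Fin (s i)); a point of ℝ^{P̂}
-- (here: rational points) is a function on elements.
Pt : (ℕ → ℕ) → Set
Pt s = (i : ℕ) → Fin (s i) → ℚ

sumBelow : (n : ℕ) → ((m : ℕ) → m < n → ℚ) → ℚ
sumBelow zero    f = 0ℚ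
sumBelow (suc n) f = sumBelow n (λ m h → f m (m<n⇒m<1+n h)) +ℚ f n ≤-refl

sumFin : {n : ℕ} → (Fin n → ℚ) → ℚ
sumFin {zero}  f = 0ℚ
sumFin {suc n} f = f Fin.zero +ℚ sumFin (λ t → f (Fin.suc t))

-- The chain-order polytope O_{C,O} for the k-decomposition of the ranked
-- poset with ranks 0..ℓ+1 of sizes s 0, …, s (ℓ+1).
-- C = ranks 0..k, O = ranks k+1..ℓ+1.

InO : (ℓ k : ℕ) (s : ℕ → ℕ) → Pt s → Set
InO ℓ k s x =
  (∀ j → x 0 j ≡ 0ℚ) ×
  (∀ j → x (suc ℓ) j ≡ 1ℚ) ×
  (∀ i → i ≤ k → ∀ j → 0ℚ ≤ℚ x i j) ×
  (∀ i → k < i → i ≤ ℓ → ∀ a b → x i a ≤ℚ x (suc i) b) ×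
  (∀ (c : (m : ℕ) → m < k → Fin (s (suc m))) (q : Fin (s (suc k))) →
     sumBelow k (λ m h → x (suc m) (c m h)) ≤ℚ x (suc k) q)

-- A maximal chain 0̂ < p_1 < … < p_k < p_{k+1} = a: p_{m+1} = c m _ ∈ Y^{m+1}.
Chain : (k : ℕ) (s : ℕ → ℕ) → Set
Chain k s = (m : ℕ) → m < suc k → Fin (s (suc m))

ChainEq : (k : ℕ) (s : ℕ → ℕ) → Chain k s → Pt s → Set
ChainEq k s c x =
  sumBelow k (λ m h → x (suc m) (c m (m<n⇒m<1+n h))) ≡ x (suc k) (c k ≤-refl)

removed : (k : ℕ) (s : ℕ → ℕ) → Chain k s → Chain k s → (i : ℕ) → Maybe (Fin (s i))
removed k s c c' zero = nothing
removed k s c c' (suc m) with m <? suc k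
... | no _ = nothing
... | yes h with c m h ≟F c' m h
...   | yes _ = nothing
...   | no _  = just (c' m h)

szM : {n : ℕ} → Maybe (Fin n) → ℕ
szM {n} nothing  = n
szM {n} (just _) = pred n

embM : {n : ℕ} (r : Maybe (Fin n)) → Fin (szM r) → Fin n
embM nothing j = j
embM {suc n} (just r) j = punchIn r j

size' : (k : ℕ) (s : ℕ → ℕ) → Chain k s → Chain k s → ℕ → ℕ
size' k s c c' i = szM (removed k s c c' i)

emb : (k : ℕ) (s : ℕ → ℕ) (c c' : Chain k s) (i : ℕ) → Fin (size' k s c c' i) → Fin (s i)
emb k s c c' i = embM (removed k s c c' i)

ν : (k : ℕ) (s : ℕ → ℕ) (c c' : Chain k s) → Pt s → Pt (size' k s c c')
ν k s c c' x i j = x i (emb k s c c' i j)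

countBelow : (n : ℕ) → ((m : ℕ) → m < n → Bool) → ℕ
countBelow zero    f = 0
countBelow (suc n) f = countBelow n (λ m h → f m (m<n⇒m<1+n h)) + (if f n ≤-refl then 1 else 0)

cardI : (k : ℕ) (s : ℕ → ℕ) → Chain k s → Chain k s → ℕ
cardI k s c c' = countBelow (suc k) (λ m h → not (isYes (c m h ≟F c' m h)))

AffInd : {s : ℕ → ℕ} {d : ℕ} → (Fin d → Pt s) → Set
AffInd {s} {d} v =
  (λc : Fin d → ℚ) → sumFin λc ≡ 0ℚ →
  (∀ i j → sumFin (λ t → λc t *ℚ v t i j) ≡ 0ℚ) →
  ∀ t → λc t ≡ 0ℚ

HasDim : {s : ℕ → ℕ} → (Pt s → Set) → ℕ → Set
HasDim {s} S d =
  (Σ (Fin (suc d) → Pt s) λ v → (∀ t → S (v t)) × AffInd v) ×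
  (∀ (v : Fin (suc (suc d)) → Pt s) → (∀ t → S (v t)) → ¬ AffInd v)

FaceF : (ℓ k : ℕ) (s : ℕ → ℕ) (c c' : Chain k s) → Pt s → Set
FaceF ℓ k s c c' x = InO ℓ k s x × ChainEq k s c x × ChainEq k s c' x

-- d is the chain p, written in the labelling of P̂_{τ'}.
FaceF' : (ℓ k : ℕ) (s : ℕ → ℕ) (c c' : Chain k s) (d : Chain k (size' k s c c')) →
         Pt (size' k s c c') → Set
FaceF' ℓ k s c c' d y = InO ℓ k (size' k s c c') y × ChainEq k (size' k s c c') d y

{-# OPTIONS --safe #-}

-- Replacing p_i by p'_i in the chain inequality and comparing
-- with the equality for p gives x_{p'_i} ≤ x_{p_i}, and symmetrically, so x_{p_i} = x_{p'_i}
-- for i ≤ k, and then x_a = x_{a'}. Thus on F the coordinates of p' ∖ p repeat surviving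
-- coordinates: ν is inverted on F' by copying them back, and since both maps only select
-- coordinates they preserve affine independence, so dim F = dim F'.
-- Both O and O' are full-dimensional in the N coordinates of the ranks 1, …, ℓ: any N + 2 of
-- their points are affinely dependent by Gaussian elimination, while every point whose
-- coordinate at a rank i ≤ k is 0 or 2^-i and at a rank k < i ≤ ℓ is 1 - 2^-(i-1) or 1 - 2^-i
-- lies in O, and one such corner together with the N corners differing from it in a single
-- coordinate is affinely independent. Passing from τ to τ' lowers N by |I|.

module Submission where

open import Defs
open import Data.Bool using (Bool; true; false; if_then_else_; not)
open import Data.Empty using (⊥-elim)
open import Data.Fin using (Fin; zero; suc; punchIn; punchOut; _↑ˡ_; _↑ʳ_; splitAt)
  renaming (_≟_ to _≟F_)
open import Data.Fin.Properties
  using (punchIn-punchOut; punchOut-punchIn; punchInᵢ≢i; punchOut-cong;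
         splitAt-↑ˡ; splitAt-↑ʳ; splitAt⁻¹-↑ˡ; splitAt⁻¹-↑ʳ; all?; ¬∀⟶∃¬; ¬Fin0)
open import Data.Maybe using (Maybe; just; nothing; maybe; is-just)
import Data.Maybe as Maybe
open import Data.Nat as ℕ using (ℕ; zero; suc; pred; s≤s; _<_; _≤_; _<?_)
import Data.Nat.Properties as ℕₚ
open import Data.Product using (Σ; Σ-syntax; ∃-syntax; _×_; _,_; proj₁; proj₂)
open import Data.Rational as ℚ using (ℚ; 0ℚ; 1ℚ; ½; 1/_; ≢-nonZero)
import Data.Rational.Properties as ℚₚ
open import Data.Sum using (_⊎_; inj₁; inj₂)
open import Function using (_∘_; id)
open import Relation.Binary using (tri<; tri≈; tri>)
open import Relation.Binary.PropositionalEquality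
open import Relation.Nullary using (¬_; yes; no; does)
open import Relation.Nullary.Decidable using (isYes; dec-true; dec-false)

module Coordinates (s : ℕ → ℕ) where

  innerSize : ℕ → ℕ
  innerSize zero    = 0
  innerSize (suc l) = innerSize l ℕ.+ s (suc l)

  -- (m , j) stands for the element j of rank suc m.
  Coord : Set
  Coord = Σ ℕ (λ m → Fin (s (suc m)))

  coord : ∀ l → Fin (innerSize l) → Coord
  coord (suc l) u with splitAt (innerSize l) u
  ... | inj₁ u' = coord l u'
  ... | inj₂ j  = l , j

  coord-rank< : ∀ l u → proj₁ (coord l u) < l
  coord-rank< (suc l) u with splitAt (innerSize l) u
  ... | inj₁ u' = ℕₚ.m<n⇒m<1+n (coord-rank< l u')
  ... | inj₂ j  = ℕₚ.n<1+n l

  coord-↑ʳ : ∀ l j → coord (suc l) (innerSize l ↑ʳ j) ≡ (l , j)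
  coord-↑ʳ l j rewrite splitAt-↑ʳ (innerSize l) (s (suc l)) j = refl

  coord-↑ˡ : ∀ l u → coord (suc l) (u ↑ˡ s (suc l)) ≡ coord l u
  coord-↑ˡ l u rewrite splitAt-↑ˡ (innerSize l) u (s (suc l)) = refl

  coord-surjective : ∀ l m → m < l → (j : Fin (s (suc m))) → ∃[ u ] coord l u ≡ (m , j)
  coord-surjective (suc l) m m<1+l j with ℕₚ.m<1+n⇒m<n∨m≡n m<1+l
  ... | inj₂ refl = innerSize l ↑ʳ j , coord-↑ʳ l j
  ... | inj₁ m<l with coord-surjective l m m<l j
  ...   | u , coord-u = u ↑ˡ s (suc l) , trans (coord-↑ˡ l u) coord-u

  index : ∀ l (m : ℕ) → Fin (s (suc m)) → Maybe (Fin (innerSize l))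
  index zero    m j = nothing
  index (suc l) m j with m ℕ.≟ l
  ... | yes refl = just (innerSize l ↑ʳ j)
  ... | no _     = Maybe.map (_↑ˡ s (suc l)) (index l m j)

  index-coord : ∀ l u → index l (proj₁ (coord l u)) (proj₂ (coord l u)) ≡ just u
  index-coord (suc l) u with splitAt (innerSize l) u in split≡
  ... | inj₁ u' with proj₁ (coord l u') ℕ.≟ l
  ...   | yes rank≡l = ⊥-elim (ℕₚ.<⇒≢ (coord-rank< l u') rank≡l)
  ...   | no _       =
    trans (cong (Maybe.map (_↑ˡ s (suc l))) (index-coord l u')) (cong just (splitAt⁻¹-↑ˡ split≡))
  index-coord (suc l) u | inj₂ j with l ℕ.≟ l
  ...   | yes refl = cong just (splitAt⁻¹-↑ʳ split≡)
  ...   | no l≢l   = ⊥-elim (l≢l refl)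

open Coordinates using (innerSize; coord; coord-rank<; coord-surjective; index; index-coord)

module AffineDimension where

  open import Data.Rational using (_+_; _*_; -_; _-_)
  open import Algebra.Bundles using (CommutativeRing)
  open import Algebra.Properties.Semiring.Sum (CommutativeRing.semiring ℚₚ.+-*-commutativeRing)
    using (sum; sum-cong-≗; sum-remove; ∑-distrib-+; *-distribʳ-sum; sum-replicate-zero)
  open import Algebra.Properties.Group ℚₚ.+-0-group using (x∙y⁻¹≈ε⇒x≈y)
  open import Data.Rational.Solver using (module +-*-Solver)
  open +-*-Solver using (solve; _:=_; _:+_; _:*_; _:-_; :-_; con)
  open import Data.Vec.Functional using (_∷_; insertAt)
  open import Data.Vec.Functional.Properties using (insertAt-lookup; insertAt-punchIn)

  sumFin≡sum : ∀ {n} (f : Fin n → ℚ) → sumFin f ≡ sum f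
  sumFin≡sum {zero}  f = refl
  sumFin≡sum {suc n} f = cong (f zero +_) (sumFin≡sum (λ t → f (suc t)))

  module _ {n : ℕ} where
    open ≡-Reasoning

    sumFin-cong : {f g : Fin n → ℚ} → (∀ t → f t ≡ g t) → sumFin f ≡ sumFin g
    sumFin-cong {f} {g} f≗g = begin
      sumFin f  ≡⟨ sumFin≡sum f ⟩
      sum f     ≡⟨ sum-cong-≗ f≗g ⟩
      sum g     ≡⟨ sumFin≡sum g ⟨
      sumFin g  ∎

    sumFin-zero : {f : Fin n → ℚ} → (∀ t → f t ≡ 0ℚ) → sumFin f ≡ 0ℚ
    sumFin-zero {f} f≗0 = begin
      sumFin f                  ≡⟨ sumFin≡sum f ⟩
      sum f                     ≡⟨ sum-cong-≗ {x = f} {y = λ (_ : Fin n) → 0ℚ} f≗0 ⟩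
      sum (λ (_ : Fin n) → 0ℚ)  ≡⟨ sum-replicate-zero n ⟩
      0ℚ                        ∎

    sumFin-+ : (f g : Fin n → ℚ) → sumFin (λ t → f t + g t) ≡ sumFin f + sumFin g
    sumFin-+ f g = begin
      sumFin (λ t → f t + g t)  ≡⟨ sumFin≡sum (λ t → f t + g t) ⟩
      sum (λ t → f t + g t)     ≡⟨ ∑-distrib-+ f g ⟩
      sum f + sum g             ≡⟨ cong₂ _+_ (sumFin≡sum f) (sumFin≡sum g) ⟨
      sumFin f + sumFin g       ∎

    sumFin-*ʳ : (f : Fin n → ℚ) (a : ℚ) → sumFin (λ t → f t * a) ≡ sumFin f * a
    sumFin-*ʳ f a = begin
      sumFin (λ t → f t * a)  ≡⟨ sumFin≡sum (λ t → f t * a) ⟩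
      sum (λ t → f t * a)     ≡⟨ *-distribʳ-sum a f ⟨
      sum f * a               ≡⟨ cong (_* a) (sumFin≡sum f) ⟨
      sumFin f * a            ∎

    sumFin-*-const : (μ g : Fin n → ℚ) {a : ℚ} → (∀ t → g t ≡ a) → sumFin μ ≡ 0ℚ →
                     sumFin (λ t → μ t * g t) ≡ 0ℚ
    sumFin-*-const μ g {a} g≗a Σμ≡0 = begin
      sumFin (λ t → μ t * g t)  ≡⟨ sumFin-cong (λ t → cong (μ t *_) (g≗a t)) ⟩
      sumFin (λ t → μ t * a)    ≡⟨ sumFin-*ʳ μ a ⟩
      sumFin μ * a              ≡⟨ cong (_* a) Σμ≡0 ⟩
      0ℚ * a                    ≡⟨ ℚₚ.*-zeroˡ a ⟩
      0ℚ                        ∎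

  sumFin-remove : ∀ {n} (i : Fin (suc n)) (f : Fin (suc n) → ℚ) →
                  sumFin f ≡ f i + sumFin (f ∘ punchIn i)
  sumFin-remove i f = begin
    sumFin f                      ≡⟨ sumFin≡sum f ⟩
    sum f                         ≡⟨ sum-remove f ⟩
    f i + sum (f ∘ punchIn i)     ≡⟨ cong (f i +_) (sumFin≡sum (f ∘ punchIn i)) ⟨
    f i + sumFin (f ∘ punchIn i)  ∎
    where open ≡-Reasoning

  sumFin-indicator : ∀ {n} (μ : Fin (suc n) → ℚ) (t₀ : Fin (suc n)) (g : Bool → ℚ) →
    sumFin (λ t → μ t * g (does (t₀ ≟F t))) ≡ μ t₀ * (g true - g false) + sumFin μ * g false
  sumFin-indicator μ t₀ g = begin
    sumFin (λ t → μ t * g (does (t₀ ≟F t)))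
      ≡⟨ sumFin-remove t₀ (λ t → μ t * g (does (t₀ ≟F t))) ⟩
    μ t₀ * g (does (t₀ ≟F t₀))
      + sumFin (λ t → μ (punchIn t₀ t) * g (does (t₀ ≟F punchIn t₀ t)))
      ≡⟨ cong₂ (λ b Σ → μ t₀ * g b + Σ) (dec-true (t₀ ≟F t₀) refl) (sumFin-cong λ t →
           cong (λ b → μ (punchIn t₀ t) * g b) (dec-false (t₀ ≟F _) (punchInᵢ≢i t₀ t ∘ sym))) ⟩
    μ t₀ * g true + sumFin (λ t → μ (punchIn t₀ t) * g false)
      ≡⟨ cong (μ t₀ * g true +_) (sumFin-*ʳ (μ ∘ punchIn t₀) (g false)) ⟩
    μ t₀ * g true + R * g false
      ≡⟨ solve 4 (λ m r x y → m :* x :+ r :* y := m :* (x :- y) :+ (m :+ r) :* y)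
                 refl (μ t₀) R (g true) (g false) ⟩
    μ t₀ * (g true - g false) + (μ t₀ + R) * g false
      ≡⟨ cong (λ Σ → μ t₀ * (g true - g false) + Σ * g false) (sumFin-remove t₀ μ) ⟨
    μ t₀ * (g true - g false) + sumFin μ * g false
      ∎
    where
    open ≡-Reasoning
    R = sumFin (μ ∘ punchIn t₀)

  p*q≡0⇒p≡0 : ∀ p q → q ≢ 0ℚ → p * q ≡ 0ℚ → p ≡ 0ℚ
  p*q≡0⇒p≡0 p q q≢0 pq≡0 = begin
    p              ≡⟨ ℚₚ.*-identityʳ p ⟨
    p * 1ℚ         ≡⟨ cong (p *_) (ℚₚ.*-inverseʳ q) ⟨
    p * (q * q⁻¹)  ≡⟨ ℚₚ.*-assoc p q q⁻¹ ⟨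
    p * q * q⁻¹    ≡⟨ cong (_* q⁻¹) pq≡0 ⟩
    0ℚ * q⁻¹       ≡⟨ ℚₚ.*-zeroˡ q⁻¹ ⟩
    0ℚ             ∎
    where
    open ≡-Reasoning
    instance _ = ≢-nonZero q≢0
    q⁻¹ = 1/ q

  LinearlyDependent : ∀ {m n} → (Fin m → Fin n → ℚ) → Set
  LinearlyDependent {m} z =
    Σ[ μ ∈ (Fin m → ℚ) ] (∀ u → sumFin (λ t → μ t * z t u) ≡ 0ℚ) × ∃[ t ] μ t ≢ 0ℚ

  linearlyDependent-zeroColumn : ∀ {m n} (z : Fin m → Fin (suc n) → ℚ) →
    (∀ t → z t zero ≡ 0ℚ) → LinearlyDependent (λ t u → z t (suc u)) → LinearlyDependent z
  linearlyDependent-zeroColumn z z₀≡0 (μ , relation , nontrivial) = μ , relation' , nontrivial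
    where
    relation' : ∀ u → sumFin (λ t → μ t * z t u) ≡ 0ℚ
    relation' zero    = sumFin-zero (λ t → trans (cong (μ t *_) (z₀≡0 t)) (ℚₚ.*-zeroʳ (μ t)))
    relation' (suc u) = relation u

  module Elimination {m n : ℕ} (z : Fin (suc m) → Fin (suc n) → ℚ) (t₀ : Fin (suc m))
                     (pivot≢0 : z t₀ zero ≢ 0ℚ) where

    a a⁻¹ : ℚ
    a   = z t₀ zero
    a⁻¹ = (1/ a) {{≢-nonZero pivot≢0}}

    reduced : Fin m → Fin n → ℚ
    reduced s u = z (punchIn t₀ s) (suc u) - (z (punchIn t₀ s) zero * a⁻¹) * z t₀ (suc u)

    linearlyDependent-reduced : LinearlyDependent reduced → LinearlyDependent z
    linearlyDependent-reduced (μ' , relation , (s₀ , μ's₀≢0)) =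
      μ , relation' , (punchIn t₀ s₀ , μ's₀≢0 ∘ trans (sym (insertAt-punchIn μ' t₀ L s₀)))
      where
      open ≡-Reasoning
      S = sumFin (λ s → μ' s * z (punchIn t₀ s) zero)
      L = - (S * a⁻¹)
      μ = insertAt μ' t₀ L

      split : ∀ u →
        sumFin (λ t → μ t * z t u) ≡ L * z t₀ u + sumFin (λ s → μ' s * z (punchIn t₀ s) u)
      split u = trans (sumFin-remove t₀ (λ t → μ t * z t u))
        (cong₂ _+_ (cong (_* z t₀ u) (insertAt-lookup μ' t₀ L))
                   (sumFin-cong (λ s → cong (_* z (punchIn t₀ s) u) (insertAt-punchIn μ' t₀ L s))))

      relation' : ∀ u → sumFin (λ t → μ t * z t u) ≡ 0ℚ
      relation' zero = begin
        sumFin (λ t → μ t * z t zero)  ≡⟨ split zero ⟩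
        L * a + S                      ≡⟨ solve 3 (λ S i a → (:- (S :* i)) :* a :+ S := S :- S :* (i :* a))
                                                  refl S a⁻¹ a ⟩
        S - S * (a⁻¹ * a)              ≡⟨ cong (λ e → S - S * e)
                                                  (ℚₚ.*-inverseˡ a {{≢-nonZero pivot≢0}}) ⟩
        S - S * 1ℚ                     ≡⟨ solve 1 (λ S → S :- S :* con 1ℚ := con 0ℚ) refl S ⟩
        0ℚ                             ∎
      relation' (suc u) = begin
        sumFin (λ t → μ t * z t (suc u))
          ≡⟨ split (suc u) ⟩
        L * K + sumFin (λ s → μ' s * A s)
          ≡⟨ solve 4 (λ S i K Σ → (:- (S :* i)) :* K :+ Σ := Σ :+ S :* (:- (i :* K)))
                     refl S a⁻¹ K _ ⟩
        sumFin (λ s → μ' s * A s) + S * M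
          ≡⟨ cong (sumFin (λ s → μ' s * A s) +_) (sumFin-*ʳ (λ s → μ' s * C s) M) ⟨
        sumFin (λ s → μ' s * A s) + sumFin (λ s → μ' s * C s * M)
          ≡⟨ sumFin-+ (λ s → μ' s * A s) (λ s → μ' s * C s * M) ⟨
        sumFin (λ s → μ' s * A s + μ' s * C s * M)
          ≡⟨ sumFin-cong (λ s → solve 5 (λ μ A C i K → μ :* A :+ μ :* C :* (:- (i :* K))
                                                     := μ :* (A :- (C :* i) :* K))
                                         refl (μ' s) (A s) (C s) a⁻¹ K) ⟩
        sumFin (λ s → μ' s * reduced s u)
          ≡⟨ relation u ⟩
        0ℚ
          ∎
        where
        K = z t₀ (suc u)
        M = - (a⁻¹ * K)
        A C : Fin m → ℚ
        A s = z (punchIn t₀ s) (suc u)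
        C s = z (punchIn t₀ s) zero

  linearlyDependent : ∀ {m n} → n < m → (z : Fin m → Fin n → ℚ) → LinearlyDependent z
  linearlyDependent {n = zero}  (s≤s _)   z = (λ _ → 1ℚ) , (λ ()) , (zero , λ ())
  linearlyDependent {n = suc n} (s≤s n<m) z with all? (λ t → z t zero ℚ.≟ 0ℚ)
  ... | yes column₀≡0 = linearlyDependent-zeroColumn z column₀≡0
                          (linearlyDependent (ℕₚ.m<n⇒m<1+n n<m) (λ t u → z t (suc u)))
  ... | no  column₀≢0 with ¬∀⟶∃¬ _ _ (λ t → z t zero ℚ.≟ 0ℚ) column₀≢0
  ...   | t₀ , pivot≢0 = Elimination.linearlyDependent-reduced z t₀ pivot≢0
                           (linearlyDependent n<m (Elimination.reduced z t₀ pivot≢0))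

  reindex : {s s' : ℕ → ℕ} → ((i : ℕ) → Fin (s' i) → Fin (s i)) → Pt s → Pt s'
  reindex σ x i j = x i (σ i j)

  module _ {s : ℕ → ℕ} where

    affInd-tail : ∀ {d} (v : Fin (suc d) → Pt s) → AffInd v → AffInd (λ t → v (suc t))
    affInd-tail v ind λc Σλc≡0 combination≡0 t = ind (0ℚ ∷ λc)
      (trans (ℚₚ.+-identityˡ _) Σλc≡0)
      (λ i j → trans (cong (_+ sumFin (λ t → λc t * v (suc t) i j)) (ℚₚ.*-zeroˡ (v zero i j)))
                     (trans (ℚₚ.+-identityˡ _) (combination≡0 i j)))
      (suc t)

    affInd-restrict : ∀ {a b} → a ≤ b → (v : Fin b → Pt s) → AffInd v →
                      Σ[ ι ∈ (Fin a → Fin b) ] AffInd (v ∘ ι)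
    affInd-restrict a≤b v ind with ℕₚ.m≤n⇒m<n∨m≡n a≤b
    ... | inj₂ refl = id , ind
    ... | inj₁ (s≤s a≤b') with affInd-restrict a≤b' (λ t → v (suc t)) (affInd-tail v ind)
    ...   | ι , ind' = suc ∘ ι , ind'

    affInd-reindex : ∀ {s' : ℕ → ℕ} {n} (σ : (i : ℕ) → Fin (s' i) → Fin (s i))
      (ρ : (i : ℕ) → Fin (s i) → Fin (s' i)) (v : Fin n → Pt s) →
      (∀ t i j → v t i (σ i (ρ i j)) ≡ v t i j) → AffInd v → AffInd (reindex σ ∘ v)
    affInd-reindex σ ρ v v∘σ∘ρ≗v ind λc Σλc≡0 combination≡0 = ind λc Σλc≡0 λ i j →
      trans (sumFin-cong (λ t → cong (λc t *_) (sym (v∘σ∘ρ≗v t i j)))) (combination≡0 i (ρ i j))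

  PreservesAffInd : {s s' : ℕ → ℕ} → (Pt s → Set) → (Pt s' → Set) → (Pt s → Pt s') → Set
  PreservesAffInd {s} S S' f =
    ∀ {n} (v : Fin n → Pt s) → (∀ t → S (v t)) → AffInd v →
    (∀ t → S' (f (v t))) × AffInd (f ∘ v)

  hasDim-mono : ∀ {s s'} {S : Pt s → Set} {S' : Pt s' → Set} {f a b} →
                PreservesAffInd S S' f → HasDim S a → HasDim S' b → a ≤ b
  hasDim-mono {f = f} preserves ((v , v∈S , ind) , _) (_ , dependent) = ℕₚ.≮⇒≥ λ b<a →
    let fv∈S' , fv-ind = preserves v v∈S ind
        ι , ι-ind      = affInd-restrict (s≤s b<a) (f ∘ v) fv-ind
    in  dependent (f ∘ v ∘ ι) (fv∈S' ∘ ι) ι-ind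

  hasDim-unique : ∀ {s} (S : Pt s → Set) {a b} → HasDim S a → HasDim S b → a ≡ b
  hasDim-unique S hasDim-a hasDim-b =
    ℕₚ.≤-antisym (hasDim-mono {S = S} {S' = S} {f = id} preserves hasDim-a hasDim-b)
                 (hasDim-mono {S = S} {S' = S} {f = id} preserves hasDim-b hasDim-a)
    where
    preserves : PreservesAffInd S S id
    preserves v v∈S ind = v∈S , ind

  Separated : ∀ {s n} → (Fin (suc n) → Pt s) → Fin n → Set
  Separated {s} v u = Σ[ i ∈ ℕ ] Σ[ j ∈ Fin (s i) ] Σ[ g ∈ (Bool → ℚ) ]
    (g true ≢ g false) × (∀ t → v t i j ≡ g (does (suc u ≟F t)))

  separated⇒affInd : ∀ {s n} (v : Fin (suc n) → Pt s) → (∀ u → Separated v u) → AffInd v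
  separated⇒affInd v separated λc Σλc≡0 combination≡0 = λc≡0
    where
    open ≡-Reasoning
    λc-suc≡0 : ∀ u → λc (suc u) ≡ 0ℚ
    λc-suc≡0 u with separated u
    ... | i , j , g , gap , v≡g =
      p*q≡0⇒p≡0 (λc (suc u)) (g true - g false) (gap ∘ x∙y⁻¹≈ε⇒x≈y _ _) (begin
      D                                            ≡⟨ ℚₚ.+-identityʳ D ⟨
      D + 0ℚ                                       ≡⟨ cong (D +_) (ℚₚ.*-zeroˡ (g false)) ⟨
      D + 0ℚ * g false                             ≡⟨ cong (λ Σ → D + Σ * g false) Σλc≡0 ⟨
      D + sumFin λc * g false                      ≡⟨ sumFin-indicator λc (suc u) g ⟨
      sumFin (λ t → λc t * g (does (suc u ≟F t)))  ≡⟨ sumFin-cong (λ t → cong (λc t *_) (v≡g t)) ⟨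
      sumFin (λ t → λc t * v t i j)                ≡⟨ combination≡0 i j ⟩
      0ℚ                                           ∎)
      where D = λc (suc u) * (g true - g false)

    λc≡0 : ∀ t → λc t ≡ 0ℚ
    λc≡0 zero = begin
      λc zero       ≡⟨ ℚₚ.+-identityʳ _ ⟨
      λc zero + 0ℚ  ≡⟨ cong (λc zero +_) (sumFin-zero λc-suc≡0) ⟨
      sumFin λc     ≡⟨ Σλc≡0 ⟩
      0ℚ            ∎
    λc≡0 (suc u) = λc-suc≡0 u

open AffineDimension
  using (reindex; affInd-reindex; PreservesAffInd; hasDim-mono; hasDim-unique)

module ChainOrderPolytope where

  open import Data.Rational using (_+_; _*_; -_)
  open AffineDimension
  open import Algebra.Bundles using (CommutativeMonoid)
  open import Algebra.Properties.Group ℚₚ.+-0-group using (identityʳ-unique)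
  open import Algebra.Properties.CommutativeSemigroup
    (CommutativeMonoid.commutativeSemigroup ℚₚ.+-0-commutativeMonoid) using (xy∙z≈xz∙y)
  open import Data.Rational.Solver using (module +-*-Solver)
  open +-*-Solver using (solve; _:=_; _:+_; _:*_; :-_; con)
  open import Data.Vec.Functional using (_∷_)

  sumBelow-cong : ∀ n {f g : (m : ℕ) → m < n → ℚ} → (∀ m h → f m h ≡ g m h) →
                  sumBelow n f ≡ sumBelow n g
  sumBelow-cong zero    f≗g = refl
  sumBelow-cong (suc n) f≗g = cong₂ _+_ (sumBelow-cong n (λ m h → f≗g m _)) (f≗g n _)

  sumBelow-mono : ∀ n {f g : (m : ℕ) → m < n → ℚ} → (∀ m h → f m h ℚ.≤ g m h) →
                  sumBelow n f ℚ.≤ sumBelow n g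
  sumBelow-mono zero    f≤g = ℚₚ.≤-refl
  sumBelow-mono (suc n) f≤g = ℚₚ.+-mono-≤ (sumBelow-mono n (λ m h → f≤g m _)) (f≤g n _)

  cong-<-irrelevant : ∀ {n} {A : ℕ → Set} (f : (m : ℕ) → m < n → A m) {m} (h h' : m < n) →
                      f m h ≡ f m h'
  cong-<-irrelevant f h h' = cong (f _) (ℕₚ.<-irrelevant h h')

  sumBelow-exchange : ∀ n (f g : (m : ℕ) → m < n → ℚ) m₀ (h₀ : m₀ < n) →
    (∀ m h → m ≢ m₀ → f m h ≡ g m h) → sumBelow n f + g m₀ h₀ ≡ sumBelow n g + f m₀ h₀
  sumBelow-exchange (suc n) f g m₀ h₀ f≗g with ℕₚ.m<1+n⇒m<n∨m≡n h₀
  ... | inj₂ refl = begin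
    Σf + f n n<1+n + g n h₀  ≡⟨ cong (λ Σ → Σ + f n n<1+n + g n h₀)
                                     (sumBelow-cong n λ m h → f≗g m _ (ℕₚ.<⇒≢ h)) ⟩
    Σg + f n n<1+n + g n h₀  ≡⟨ xy∙z≈xz∙y Σg (f n n<1+n) (g n h₀) ⟩
    Σg + g n h₀ + f n n<1+n  ≡⟨ cong₂ (λ a b → Σg + a + b) (cong-<-irrelevant g h₀ n<1+n)
                                                          (cong-<-irrelevant f n<1+n h₀) ⟩
    Σg + g n n<1+n + f n h₀  ∎
    where
    open ≡-Reasoning
    n<1+n = ℕₚ.n<1+n n
    Σf = sumBelow n (λ m h → f m (ℕₚ.m<n⇒m<1+n h))
    Σg = sumBelow n (λ m h → g m (ℕₚ.m<n⇒m<1+n h))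
  ... | inj₁ m₀<n = begin
    Σf + f n n<1+n + g m₀ h₀  ≡⟨ xy∙z≈xz∙y Σf (f n n<1+n) (g m₀ h₀) ⟩
    Σf + g m₀ h₀ + f n n<1+n  ≡⟨ cong₂ _+_ exchanged (f≗g n n<1+n (ℕₚ.<⇒≢ m₀<n ∘ sym)) ⟩
    Σg + f m₀ h₀ + g n n<1+n  ≡⟨ xy∙z≈xz∙y Σg (f m₀ h₀) (g n n<1+n) ⟩
    Σg + g n n<1+n + f m₀ h₀  ∎
    where
    open ≡-Reasoning
    n<1+n = ℕₚ.n<1+n n
    f↓ g↓ : (m : ℕ) → m < n → ℚ
    f↓ m h = f m (ℕₚ.m<n⇒m<1+n h)
    g↓ m h = g m (ℕₚ.m<n⇒m<1+n h)
    Σf = sumBelow n f↓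
    Σg = sumBelow n g↓
    exchanged : Σf + g m₀ h₀ ≡ Σg + f m₀ h₀
    exchanged = begin
      Σf + g m₀ h₀     ≡⟨ cong (Σf +_) (cong-<-irrelevant g h₀ _) ⟩
      Σf + g↓ m₀ m₀<n  ≡⟨ sumBelow-exchange n f↓ g↓ m₀ m₀<n (λ m h → f≗g m _) ⟩
      Σg + f↓ m₀ m₀<n  ≡⟨ cong (Σg +_) (cong-<-irrelevant f _ h₀) ⟩
      Σg + f m₀ h₀     ∎

  A+q≡B+p⇒A≤B⇒p≤q : ∀ {A B p q} → A + q ≡ B + p → A ℚ.≤ B → p ℚ.≤ q
  A+q≡B+p⇒A≤B⇒p≤q {A} {B} {p} {q} A+q≡B+p A≤B = begin
    p              ≡⟨ solve 2 (λ B p → p := (:- B) :+ (B :+ p)) refl B p ⟩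
    - B + (B + p)  ≡⟨ cong (- B +_) A+q≡B+p ⟨
    - B + (A + q)  ≤⟨ ℚₚ.+-monoʳ-≤ (- B) (ℚₚ.+-monoˡ-≤ q A≤B) ⟩
    - B + (B + q)  ≡⟨ solve 2 (λ B q → (:- B) :+ (B :+ q) := q) refl B q ⟩
    q              ∎
    where open ℚₚ.≤-Reasoning

  chainEq-exchange-≤ : ∀ {ℓ k s x} → InO ℓ k s x → (c₁ c₂ : Chain k s) → ChainEq k s c₁ x →
    ∀ m₀ (h₀ : m₀ < k) →
    x (suc m₀) (c₂ m₀ (ℕₚ.m<n⇒m<1+n h₀)) ℚ.≤ x (suc m₀) (c₁ m₀ (ℕₚ.m<n⇒m<1+n h₀))
  chainEq-exchange-≤ {ℓ} {k} {s} {x} (_ , _ , _ , _ , chainIneq) c₁ c₂ tight m₀ h₀ =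
    A+q≡B+p⇒A≤B⇒p≤q (trans (sumBelow-exchange k f g m₀ h₀ f≗g) (cong (sumBelow k g +_) f-at-m₀))
                    (subst (sumBelow k f ℚ.≤_) (sym tight) (chainIneq exchanged (c₁ k ℕₚ.≤-refl)))
    where
    exchanged : (m : ℕ) → m < k → Fin (s (suc m))
    exchanged m h with m ℕ.≟ m₀
    ... | yes _ = c₂ m (ℕₚ.m<n⇒m<1+n h)
    ... | no _  = c₁ m (ℕₚ.m<n⇒m<1+n h)

    f g : (m : ℕ) → m < k → ℚ
    f m h = x (suc m) (exchanged m h)
    g m h = x (suc m) (c₁ m (ℕₚ.m<n⇒m<1+n h))

    f≗g : ∀ m h → m ≢ m₀ → f m h ≡ g m h
    f≗g m h m≢m₀ with m ℕ.≟ m₀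
    ... | yes m≡m₀ = ⊥-elim (m≢m₀ m≡m₀)
    ... | no _     = refl

    f-at-m₀ : f m₀ h₀ ≡ x (suc m₀) (c₂ m₀ (ℕₚ.m<n⇒m<1+n h₀))
    f-at-m₀ with m₀ ℕ.≟ m₀
    ... | yes _     = refl
    ... | no m₀≢m₀ = ⊥-elim (m₀≢m₀ refl)

  faceF-agree-below : ∀ {ℓ k s c c' x} → FaceF ℓ k s c c' x → ∀ m (h : m < k) →
    x (suc m) (c m (ℕₚ.m<n⇒m<1+n h)) ≡ x (suc m) (c' m (ℕₚ.m<n⇒m<1+n h))
  faceF-agree-below {c = c} {c'} (x∈O , tight , tight') m h =
    ℚₚ.≤-antisym (chainEq-exchange-≤ x∈O c' c tight' m h) (chainEq-exchange-≤ x∈O c c' tight m h)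

  faceF-agree : ∀ {ℓ k s c c' x} → FaceF ℓ k s c c' x →
                ∀ m h → x (suc m) (c m h) ≡ x (suc m) (c' m h)
  faceF-agree {ℓ} {k} {s} {c} {c'} {x} x∈F m h with ℕₚ.m<1+n⇒m<n∨m≡n h
  ... | inj₁ m<k = begin
    x (suc m) (c m h)    ≡⟨ cong (x (suc m)) (cong-<-irrelevant c h h') ⟩
    x (suc m) (c m h')   ≡⟨ faceF-agree-below {c = c} {c'} x∈F m m<k ⟩
    x (suc m) (c' m h')  ≡⟨ cong (x (suc m)) (cong-<-irrelevant c' h' h) ⟩
    x (suc m) (c' m h)   ∎
    where
    open ≡-Reasoning
    h' = ℕₚ.m<n⇒m<1+n m<k
  ... | inj₂ refl = begin
    x (suc k) (c k h)                                       ≡⟨ cong (x (suc k)) (cong-<-irrelevant c h h') ⟩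
    x (suc k) (c k h')                                      ≡⟨ proj₁ (proj₂ x∈F) ⟨
    sumBelow k (λ m h → x (suc m) (c m (ℕₚ.m<n⇒m<1+n h)))
      ≡⟨ sumBelow-cong k (faceF-agree-below {c = c} {c'} x∈F) ⟩
    sumBelow k (λ m h → x (suc m) (c' m (ℕₚ.m<n⇒m<1+n h)))  ≡⟨ proj₂ (proj₂ x∈F) ⟩
    x (suc k) (c' k h')                                     ≡⟨ cong (x (suc k)) (cong-<-irrelevant c' h' h) ⟩
    x (suc k) (c' k h)                                      ∎
    where
    open ≡-Reasoning
    h' = ℕₚ.n<1+n k

  module _ {k : ℕ} {s s' : ℕ → ℕ} (σ : (i : ℕ) → Fin (s' i) → Fin (s i)) where

    inO-reindex : ∀ {ℓ x} → InO ℓ k s x → InO ℓ k s' (reindex σ x)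
    inO-reindex {ℓ} (bottom , top , nonneg , ordered , chainIneq) =
      (λ j → bottom (σ 0 j)) , (λ j → top (σ (suc ℓ) j)) , (λ i i≤k j → nonneg i i≤k (σ i j)) ,
      (λ i k<i i≤ℓ a b → ordered i k<i i≤ℓ (σ i a) (σ (suc i) b)) ,
      (λ p q → chainIneq (λ m h → σ (suc m) (p m h)) (σ (suc k) q))

    chainEq-reindex : ∀ {x} (c : Chain k s) (c' : Chain k s') → (∀ m h → σ (suc m) (c' m h) ≡ c m h) →
                      ChainEq k s c x → ChainEq k s' c' (reindex σ x)
    chainEq-reindex {x} c c' σc'≡c tight =
      trans (sumBelow-cong k (λ m h → cong (x (suc m)) (σc'≡c m _)))
            (trans tight (cong (x (suc k)) (sym (σc'≡c k _))))

  inO-affDependent : ∀ {ℓ k s} → (∀ m → ℓ < m → s (suc m) ≡ 0) →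
    (v : Fin (suc (suc (innerSize s ℓ))) → Pt s) → (∀ t → InO ℓ k s (v t)) → ¬ AffInd v
  inO-affDependent {ℓ} {k} {s} s-beyond≡0 v v∈O ind = independent (linearlyDependent (ℕₚ.n<1+n _) rows)
    where
    rows : Fin (suc (suc (innerSize s ℓ))) → Fin (suc (innerSize s ℓ)) → ℚ
    rows t = 1ℚ ∷ λ u → v t (suc (proj₁ (coord s ℓ u))) (proj₂ (coord s ℓ u))

    independent : ¬ LinearlyDependent rows
    independent (μ , relation , t , μt≢0) = μt≢0 (ind μ Σμ≡0 combination≡0 t)
      where
      Σμ≡0 : sumFin μ ≡ 0ℚ
      Σμ≡0 = trans (sumFin-cong (λ t → sym (ℚₚ.*-identityʳ (μ t)))) (relation zero)

      combination≡0 : ∀ i j → sumFin (λ t → μ t * v t i j) ≡ 0ℚ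
      combination≡0 zero j = sumFin-*-const μ (λ t → v t 0 j) (λ t → proj₁ (v∈O t) j) Σμ≡0
      combination≡0 (suc m) j with ℕₚ.<-cmp m ℓ
      ... | tri≈ _ refl _ =
        sumFin-*-const μ (λ t → v t (suc m) j) (λ t → proj₁ (proj₂ (v∈O t)) j) Σμ≡0
      ... | tri> _ _ ℓ<m  = ⊥-elim (¬Fin0 (subst Fin (s-beyond≡0 m ℓ<m) j))
      ... | tri< m<ℓ _ _ with coord-surjective s ℓ m m<ℓ j
      ...   | u , coord-u =
        trans (cong (λ p → sumFin (λ t → μ t * v t (suc (proj₁ p)) (proj₂ p))) (sym coord-u))
              (relation (suc u))

  ½^_ : ℕ → ℚ
  ½^ zero    = 1ℚ
  ½^ (suc n) = ½ * ½^ n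

  ½^-pos : ∀ n → 0ℚ ℚ.< ½^ n
  ½^-pos zero    = ℚₚ.positive⁻¹ 1ℚ
  ½^-pos (suc n) = ℚₚ.*-monoʳ-<-pos ½ (½^-pos n)

  Σ½^ : ℕ → ℚ
  Σ½^ n = sumBelow n (λ m _ → ½^ (suc m))

  Σ½^+½^≡1 : ∀ n → Σ½^ n + ½^ n ≡ 1ℚ
  Σ½^+½^≡1 zero    = refl
  Σ½^+½^≡1 (suc n) = begin
    Σ½^ n + ½^ (suc n) + ½^ (suc n)    ≡⟨ ℚₚ.+-assoc (Σ½^ n) (½^ (suc n)) (½^ (suc n)) ⟩
    Σ½^ n + (½^ (suc n) + ½^ (suc n))  ≡⟨ cong (Σ½^ n +_) ½x+½x≡x ⟩
    Σ½^ n + ½^ n                       ≡⟨ Σ½^+½^≡1 n ⟩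
    1ℚ                                 ∎
    where
    open ≡-Reasoning
    ½x+½x≡x : ½ * ½^ n + ½ * ½^ n ≡ ½^ n
    ½x+½x≡x = solve 1 (λ x → con ½ :* x :+ con ½ :* x := x) refl (½^ n)

  p≤p+q : ∀ p {q} → 0ℚ ℚ.≤ q → p ℚ.≤ p + q
  p≤p+q p {q} 0≤q = subst (ℚ._≤ p + q) (ℚₚ.+-identityʳ p) (ℚₚ.+-monoʳ-≤ p 0≤q)

  Σ½^-≤-suc : ∀ n → Σ½^ n ℚ.≤ Σ½^ (suc n)
  Σ½^-≤-suc n = p≤p+q (Σ½^ n) (ℚₚ.<⇒≤ (½^-pos (suc n)))

  Σ½^≤1 : ∀ n → Σ½^ n ℚ.≤ 1ℚ
  Σ½^≤1 n = subst (Σ½^ n ℚ.≤_) (Σ½^+½^≡1 n) (p≤p+q (Σ½^ n) (ℚₚ.<⇒≤ (½^-pos n)))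

  Σ½^-suc≢ : ∀ n → Σ½^ (suc n) ≢ Σ½^ n
  Σ½^-suc≢ n eq = ℚₚ.<⇒≢ (½^-pos (suc n)) (sym (identityʳ-unique (Σ½^ n) (½^ (suc n)) eq))

  module Cube (ℓ k : ℕ) (k<ℓ : k < ℓ) where

    level : ℕ → Bool → ℚ
    level zero    _ = 0ℚ
    level (suc m) b with m ℕ.≟ ℓ | m <? k
    ... | yes _ | _     = 1ℚ
    ... | no _  | yes _ = if b then ½^ (suc m) else 0ℚ
    ... | no _  | no _  = Σ½^ (if b then suc m else m)

    level-top : ∀ {m} → m ≡ ℓ → ∀ b → level (suc m) b ≡ 1ℚ
    level-top {m} m≡ℓ b with m ℕ.≟ ℓ
    ... | yes _   = refl
    ... | no m≢ℓ = ⊥-elim (m≢ℓ m≡ℓ)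

    level-C : ∀ {m} → m < k → ∀ b → level (suc m) b ≡ (if b then ½^ (suc m) else 0ℚ)
    level-C {m} m<k b with m ℕ.≟ ℓ | m <? k
    ... | yes m≡ℓ | _      = ⊥-elim (ℕₚ.<⇒≢ (ℕₚ.<-trans m<k k<ℓ) m≡ℓ)
    ... | no _    | yes _  = refl
    ... | no _    | no m≮k = ⊥-elim (m≮k m<k)

    level-O : ∀ {m} → k ≤ m → m < ℓ → ∀ b → level (suc m) b ≡ Σ½^ (if b then suc m else m)
    level-O {m} k≤m m<ℓ b with m ℕ.≟ ℓ | m <? k
    ... | yes m≡ℓ | _       = ⊥-elim (ℕₚ.<⇒≢ m<ℓ m≡ℓ)
    ... | no _    | yes m<k = ⊥-elim (ℕₚ.≤⇒≯ k≤m m<k)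
    ... | no _    | no _    = refl

    level-C-≥0 : ∀ {m} → m < k → ∀ b → 0ℚ ℚ.≤ level (suc m) b
    level-C-≥0 {m} m<k true  rewrite level-C m<k true  = ℚₚ.<⇒≤ (½^-pos (suc m))
    level-C-≥0     m<k false rewrite level-C m<k false = ℚₚ.≤-refl

    level-C-≤ : ∀ {m} → m < k → ∀ b → level (suc m) b ℚ.≤ ½^ (suc m)
    level-C-≤     m<k true  rewrite level-C m<k true  = ℚₚ.≤-refl
    level-C-≤ {m} m<k false rewrite level-C m<k false = ℚₚ.<⇒≤ (½^-pos (suc m))

    level-O-≥ : ∀ {m} → k ≤ m → m < ℓ → ∀ b → Σ½^ m ℚ.≤ level (suc m) b
    level-O-≥ {m} k≤m m<ℓ true  rewrite level-O k≤m m<ℓ true  = Σ½^-≤-suc m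
    level-O-≥     k≤m m<ℓ false rewrite level-O k≤m m<ℓ false = ℚₚ.≤-refl

    level-O-≤ : ∀ {m} → k ≤ m → m < ℓ → ∀ b → level (suc m) b ℚ.≤ Σ½^ (suc m)
    level-O-≤     k≤m m<ℓ true  rewrite level-O k≤m m<ℓ true  = ℚₚ.≤-refl
    level-O-≤ {m} k≤m m<ℓ false rewrite level-O k≤m m<ℓ false = Σ½^-≤-suc m

    level-gap : ∀ {m} → m < ℓ → level (suc m) true ≢ level (suc m) false
    level-gap {m} m<ℓ with ℕₚ.<-≤-connex m k
    ... | inj₁ m<k rewrite level-C m<k true | level-C m<k false = ℚₚ.<⇒≢ (½^-pos (suc m)) ∘ sym
    ... | inj₂ k≤m rewrite level-O k≤m m<ℓ true | level-O k≤m m<ℓ false = Σ½^-suc≢ m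

    cube-inO : ∀ {s} (β : (i : ℕ) → Fin (s i) → Bool) → InO ℓ k s (λ i j → level i (β i j))
    cube-inO {s} β = (λ _ → refl) , (λ j → level-top refl _) , nonneg , ordered , chainIneq
      where
      nonneg : ∀ i → i ≤ k → ∀ j → 0ℚ ℚ.≤ level i (β i j)
      nonneg zero    _   _ = ℚₚ.≤-refl
      nonneg (suc m) m<k j = level-C-≥0 m<k (β (suc m) j)

      ordered : ∀ i → k < i → i ≤ ℓ → ∀ a b → level i (β i a) ℚ.≤ level (suc i) (β (suc i) b)
      ordered (suc m) (s≤s k≤m) m<ℓ a b =
        ℚₚ.≤-trans (level-O-≤ k≤m m<ℓ _) (next (ℕₚ.m≤n⇒m<n∨m≡n m<ℓ))
        where
        next : suc m < ℓ ⊎ suc m ≡ ℓ → Σ½^ (suc m) ℚ.≤ level (suc (suc m)) (β (suc (suc m)) b)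
        next (inj₁ 1+m<ℓ) = level-O-≥ (ℕₚ.m≤n⇒m≤1+n k≤m) 1+m<ℓ _
        next (inj₂ 1+m≡ℓ) = subst (Σ½^ (suc m) ℚ.≤_) (sym (level-top 1+m≡ℓ _)) (Σ½^≤1 (suc m))

      chainIneq : ∀ (p : (m : ℕ) → m < k → Fin (s (suc m))) q →
        sumBelow k (λ m h → level (suc m) (β (suc m) (p m h))) ℚ.≤ level (suc k) (β (suc k) q)
      chainIneq p q =
        ℚₚ.≤-trans (sumBelow-mono k (λ m m<k → level-C-≤ m<k _)) (level-O-≥ ℕₚ.≤-refl k<ℓ _)

    module Simplex {s : ℕ → ℕ} where

      -- Vertex zero is the corner with all bits false; vertex (suc u) sets only the bit of
      -- the u-th element of the ranks 1, …, ℓ.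
      corner : Fin (suc (innerSize s ℓ)) → (i : ℕ) → Fin (s i) → Bool
      corner t zero    j = false
      corner t (suc m) j = maybe (λ u → does (suc u ≟F t)) false (index s ℓ m j)

      vertex : Fin (suc (innerSize s ℓ)) → Pt s
      vertex t i j = level i (corner t i j)

      vertex-separated : ∀ u → Separated vertex u
      vertex-separated u = suc m , j , level (suc m) , level-gap (coord-rank< s ℓ u) , λ t →
        cong (λ r → level (suc m) (maybe (λ u' → does (suc u' ≟F t)) false r)) (index-coord s ℓ u)
        where
        m = proj₁ (coord s ℓ u)
        j = proj₂ (coord s ℓ u)

  inO-hasDim : ∀ {ℓ k s} → k < ℓ → (∀ m → ℓ < m → s (suc m) ≡ 0) →
               HasDim (InO ℓ k s) (innerSize s ℓ)
  inO-hasDim {ℓ} {k} {s} k<ℓ s-beyond≡0 =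
    (vertex , (λ t → cube-inO (corner t)) , separated⇒affInd vertex vertex-separated) ,
    inO-affDependent s-beyond≡0
    where
    open Cube ℓ k k<ℓ
    open Simplex {s}

open ChainOrderPolytope using (faceF-agree; inO-reindex; chainEq-reindex; inO-hasDim)

open import Data.Nat using (_+_)
open import Data.List using (List; []; _∷_; length)
open import Data.List.Relation.Unary.All using (All)
open import Algebra.Properties.CommutativeSemigroup ℕₚ.+-commutativeSemigroup
  using (interchange; xy∙z≈xz∙y)

countBelow-cong : ∀ n {f g : (m : ℕ) → m < n → Bool} → (∀ m h → f m h ≡ g m h) →
                  countBelow n f ≡ countBelow n g
countBelow-cong zero    f≗g = refl
countBelow-cong (suc n) f≗g =
  cong₂ _+_ (countBelow-cong n (λ m h → f≗g m _)) (cong (λ b → if b then 1 else 0) (f≗g n _))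

countBelow-beyond : ∀ {n l} (g : ℕ → Bool) → n ≤ l → (∀ m → n ≤ m → g m ≡ false) →
                    countBelow l (λ m _ → g m) ≡ countBelow n (λ m _ → g m)
countBelow-beyond g n≤l g≡false with ℕₚ.m≤n⇒m<n∨m≡n n≤l
... | inj₂ refl = refl
... | inj₁ (s≤s {n = l'} n≤l') =
  trans (cong (λ b → countBelow l' (λ m _ → g m) + (if b then 1 else 0)) (g≡false l' n≤l'))
        (trans (ℕₚ.+-identityʳ _) (countBelow-beyond g n≤l' g≡false))

szM-count : ∀ {n} (r : Maybe (Fin n)) → n ≡ szM r + (if is-just r then 1 else 0)
szM-count         nothing  = sym (ℕₚ.+-identityʳ _)
szM-count {suc n} (just _) = ℕₚ.+-comm 1 n

innerSize-szM : ∀ {s} (r : (i : ℕ) → Maybe (Fin (s i))) l →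
  innerSize s l ≡ innerSize (λ i → szM (r i)) l + countBelow l (λ m _ → is-just (r (suc m)))
innerSize-szM r zero    = refl
innerSize-szM r (suc l) =
  trans (cong₂ _+_ (innerSize-szM r l) (szM-count (r (suc l))))
        (interchange (innerSize (λ i → szM (r i)) l) (countBelow l (λ m _ → is-just (r (suc m))))
                     (szM (r (suc l))) (if is-just (r (suc l)) then 1 else 0))

-- The left inverse of punchIn r that sends r to where a goes.
merge : ∀ {n} (r a : Fin n) → a ≢ r → Fin n → Fin (pred n)
merge {suc n} r a a≢r j with j ≟F r
... | yes _  = punchOut (a≢r ∘ sym)
... | no j≢r = punchOut (j≢r ∘ sym)

merge-embM : ∀ {n} (r a : Fin n) (a≢r : a ≢ r) j → merge r a a≢r (embM (just r) j) ≡ j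
merge-embM {suc n} r a a≢r j with punchIn r j ≟F r
... | yes r'≡r = ⊥-elim (punchInᵢ≢i r j r'≡r)
... | no _     = trans (punchOut-cong r refl) (punchOut-punchIn r)

merge-removed : ∀ {n} (r a : Fin n) (a≢r : a ≢ r) → merge r a a≢r r ≡ merge r a a≢r a
merge-removed {suc n} r a a≢r with r ≟F r | a ≟F r
... | no r≢r | _       = ⊥-elim (r≢r refl)
... | yes _  | yes a≡r = ⊥-elim (a≢r a≡r)
... | yes _  | no _    = punchOut-cong r refl

embM-merge : ∀ {n} {A : Set} (x : Fin n → A) (r a : Fin n) (a≢r : a ≢ r) → x r ≡ x a →
             ∀ j → x (embM (just r) (merge r a a≢r j)) ≡ x j
embM-merge {suc n} x r a a≢r xr≡xa j with j ≟F r
... | yes refl = trans (cong x (punchIn-punchOut (a≢r ∘ sym))) (sym xr≡xa)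
... | no j≢r   = cong x (punchIn-punchOut (j≢r ∘ sym))

module Restriction (k : ℕ) (s : ℕ → ℕ) (c c' : Chain k s) where

  s' : ℕ → ℕ
  s' = size' k s c c'

  collapse : (i : ℕ) → Fin (s i) → Fin (s' i)
  collapse zero    j = j
  collapse (suc m) j with m <? suc k
  ... | no _ = j
  ... | yes h with c m h ≟F c' m h
  ...   | yes _    = j
  ...   | no  c≢c' = merge (c' m h) (c m h) c≢c' j

  collapse-emb : ∀ i j → collapse i (emb k s c c' i j) ≡ j
  collapse-emb zero    j = refl
  collapse-emb (suc m) j with m <? suc k
  ... | no _ = refl
  ... | yes h with c m h ≟F c' m h
  ...   | yes _    = refl
  ...   | no  c≢c' = merge-embM (c' m h) (c m h) c≢c' j

  emb-collapse : (x : Pt s) → (∀ m h → x (suc m) (c m h) ≡ x (suc m) (c' m h)) →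
                 ∀ i j → x i (emb k s c c' i (collapse i j)) ≡ x i j
  emb-collapse x agree zero    j = refl
  emb-collapse x agree (suc m) j with m <? suc k
  ... | no _ = refl
  ... | yes h with c m h ≟F c' m h
  ...   | yes _    = refl
  ...   | no  c≢c' = embM-merge (x (suc m)) (c' m h) (c m h) c≢c' (sym (agree m h)) j

  collapse-c' : ∀ m h → collapse (suc m) (c' m h) ≡ collapse (suc m) (c m h)
  collapse-c' m h with m <? suc k
  ... | no m≮1+k = ⊥-elim (m≮1+k h)
  ... | yes h' with ℕₚ.<-irrelevant h h'
  ...   | refl with c m h ≟F c' m h
  ...     | yes c≡c' = sym c≡c'
  ...     | no  c≢c' = merge-removed (c' m h) (c m h) c≢c'

  removed-beyond : ∀ m → k < m → removed k s c c' (suc m) ≡ nothing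
  removed-beyond m k<m with m <? suc k
  ... | no _      = refl
  ... | yes m<1+k = ⊥-elim (ℕₚ.≤⇒≯ (ℕₚ.≤-pred m<1+k) k<m)

  is-just-removed : ∀ m h → is-just (removed k s c c' (suc m)) ≡ not (isYes (c m h ≟F c' m h))
  is-just-removed m h with m <? suc k
  ... | no m≮1+k = ⊥-elim (m≮1+k h)
  ... | yes h' with ℕₚ.<-irrelevant h h'
  ...   | refl with c m h ≟F c' m h
  ...     | yes _ = refl
  ...     | no  _ = refl

  innerSize-size' : ∀ l → k < l → innerSize s l ≡ innerSize s' l + cardI k s c c'
  innerSize-size' l k<l =
    trans (innerSize-szM (removed k s c c') l) (cong (innerSize s' l +_) removedCount)
    where
    removedCount : countBelow l (λ m _ → is-just (removed k s c c' (suc m))) ≡ cardI k s c c'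
    removedCount = trans (countBelow-beyond (λ m → is-just (removed k s c c' (suc m))) k<l
                                            (λ m k<m → cong is-just (removed-beyond m k<m)))
                         (countBelow-cong (suc k) is-just-removed)

  inO-dim-removed : ∀ {ℓ dO dO'} → k < ℓ → (∀ m → ℓ < m → s (suc m) ≡ 0) →
    HasDim (InO ℓ k s) dO → HasDim (InO ℓ k s') dO' → dO ≡ dO' + cardI k s c c'
  inO-dim-removed {ℓ} {dO} {dO'} k<ℓ s-beyond≡0 hasDim-O hasDim-O' = begin
    dO                               ≡⟨ hasDim-unique (InO ℓ k s) hasDim-O (inO-hasDim k<ℓ s-beyond≡0) ⟩
    innerSize s ℓ                    ≡⟨ innerSize-size' ℓ k<ℓ ⟩
    innerSize s' ℓ + cardI k s c c'  ≡⟨ cong (_+ cardI k s c c') dO'≡ ⟨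
    dO' + cardI k s c c'             ∎
    where
    open ≡-Reasoning
    s'-beyond≡0 : ∀ m → ℓ < m → s' (suc m) ≡ 0
    s'-beyond≡0 m ℓ<m = trans (cong szM (removed-beyond m (ℕₚ.<-trans k<ℓ ℓ<m))) (s-beyond≡0 m ℓ<m)
    dO'≡ : dO' ≡ innerSize s' ℓ
    dO'≡ = hasDim-unique (InO ℓ k s') hasDim-O' (inO-hasDim k<ℓ s'-beyond≡0)

module Isomorphism (ℓ k : ℕ) (s : ℕ → ℕ) (c c' : Chain k s) (d : Chain k (size' k s c c'))
                   (d≡c : ∀ m h → emb k s c c' (suc m) (d m h) ≡ c m h) where

  open Restriction k s c c'

  lift : Pt s' → Pt s
  lift = reindex collapse

  collapse-c≡d : ∀ m h → collapse (suc m) (c m h) ≡ d m h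
  collapse-c≡d m h = trans (cong (collapse (suc m)) (sym (d≡c m h))) (collapse-emb (suc m) (d m h))

  ν-faceF : ∀ x → FaceF ℓ k s c c' x → FaceF' ℓ k s c c' d (ν k s c c' x)
  ν-faceF x (x∈O , tight , _) =
    inO-reindex (emb k s c c') x∈O , chainEq-reindex (emb k s c c') {x} c d d≡c tight

  lift-faceF' : ∀ y → FaceF' ℓ k s c c' d y → FaceF ℓ k s c c' (lift y)
  lift-faceF' y (y∈O , tight) =
    inO-reindex collapse y∈O ,
    chainEq-reindex collapse {y} d c collapse-c≡d tight ,
    chainEq-reindex collapse {y} d c' (λ m h → trans (collapse-c' m h) (collapse-c≡d m h)) tight

  ν-lift : ∀ y i j → ν k s c c' (lift y) i j ≡ y i j
  ν-lift y i j = cong (y i) (collapse-emb i j)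

  lift-ν : ∀ {x} → FaceF ℓ k s c c' x → ∀ i j → lift (ν k s c c' x) i j ≡ x i j
  lift-ν {x} x∈F = emb-collapse x (faceF-agree x∈F)

  ν-injective : ∀ x x' → FaceF ℓ k s c c' x → FaceF ℓ k s c c' x' →
    (∀ i j → ν k s c c' x i j ≡ ν k s c c' x' i j) → ∀ i j → x i j ≡ x' i j
  ν-injective x x' x∈F x'∈F νx≡νx' i j =
    trans (sym (lift-ν x∈F i j)) (trans (νx≡νx' i (collapse i j)) (lift-ν x'∈F i j))

  ν-surjective : ∀ y → FaceF' ℓ k s c c' d y →
    Σ (Pt s) λ x → FaceF ℓ k s c c' x × (∀ i j → ν k s c c' x i j ≡ y i j)
  ν-surjective y y∈F' = lift y , lift-faceF' y y∈F' , ν-lift y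

  faceF-dim≡faceF'-dim : ∀ {a b} → HasDim (FaceF ℓ k s c c') a → HasDim (FaceF' ℓ k s c c' d) b →
                         a ≡ b
  faceF-dim≡faceF'-dim hasDim-F hasDim-F' =
    ℕₚ.≤-antisym (hasDim-mono {S = F} {S' = F'} {f = ν k s c c'} ν-preserves hasDim-F hasDim-F')
                 (hasDim-mono {S = F'} {S' = F} {f = lift} lift-preserves hasDim-F' hasDim-F)
    where
    F = FaceF ℓ k s c c'
    F' = FaceF' ℓ k s c c' d

    ν-preserves : PreservesAffInd F F' (ν k s c c')
    ν-preserves v v∈F ind =
      (λ t → ν-faceF (v t) (v∈F t)) ,
      affInd-reindex (emb k s c c') collapse v (λ t → lift-ν (v∈F t)) ind

    lift-preserves : PreservesAffInd F' F lift
    lift-preserves v v∈F' ind =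
      (λ t → lift-faceF' (v t) (v∈F' t)) ,
      affInd-reindex collapse (emb k s c c') v (λ t → ν-lift (v t)) ind

  codim-faceF : k < ℓ → (∀ m → ℓ < m → s (suc m) ≡ 0) → ∀ dO dF dO' dF' →
    HasDim (InO ℓ k s) dO → HasDim (FaceF ℓ k s c c') dF →
    HasDim (InO ℓ k s') dO' → HasDim (FaceF' ℓ k s c c' d) dF' →
    dO + dF' ≡ dO' + dF + cardI k s c c'
  codim-faceF k<ℓ s-beyond≡0 dO dF dO' dF' hasDim-O hasDim-F hasDim-O' hasDim-F' = begin
    dO + dF'                      ≡⟨ cong₂ _+_ (inO-dim-removed k<ℓ s-beyond≡0 hasDim-O hasDim-O')
                                               (sym (faceF-dim≡faceF'-dim hasDim-F hasDim-F')) ⟩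
    dO' + cardI k s c c' + dF     ≡⟨ xy∙z≈xz∙y dO' (cardI k s c c') dF ⟩
    dO' + dF + cardI k s c c'     ∎
    where open ≡-Reasoning

sizeOf-beyond≡0 : ∀ τ m → length τ < m → sizeOf τ (suc m) ≡ 0
sizeOf-beyond≡0 []      (suc m) _         = refl
sizeOf-beyond≡0 (_ ∷ τ) (suc m) (s≤s ℓ<m) = sizeOf-beyond≡0 τ m ℓ<m

proposition3p7 :
    (τ : List ℕ) → All (0 <_) τ →
    (k : ℕ) → k < length τ →
    (c c' : Chain k (sizeOf τ)) →
    (d : Chain k (size' k (sizeOf τ) c c')) →
    (∀ m h → emb k (sizeOf τ) c c' (suc m) (d m h) ≡ c m h) →
    -- ν maps F into F'
    (∀ x → FaceF (length τ) k (sizeOf τ) c c' x →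
       FaceF' (length τ) k (sizeOf τ) c c' d (ν k (sizeOf τ) c c' x)) ×
    -- ν is injective on F
    (∀ x x' → FaceF (length τ) k (sizeOf τ) c c' x → FaceF (length τ) k (sizeOf τ) c c' x' →
       (∀ i j → ν k (sizeOf τ) c c' x i j ≡ ν k (sizeOf τ) c c' x' i j) →
       ∀ i j → x i j ≡ x' i j) ×
    -- ν maps F onto F'
    (∀ y → FaceF' (length τ) k (sizeOf τ) c c' d y →
       Σ (Pt (sizeOf τ)) λ x → FaceF (length τ) k (sizeOf τ) c c' x ×
         (∀ i j → ν k (sizeOf τ) c c' x i j ≡ y i j)) ×
    -- codim F = codim F' + |I|
    (∀ dO dF dO' dF' →
       HasDim (InO (length τ) k (sizeOf τ)) dO →
       HasDim (FaceF (length τ) k (sizeOf τ) c c') dF →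
       HasDim (InO (length τ) k (size' k (sizeOf τ) c c')) dO' →
       HasDim (FaceF' (length τ) k (sizeOf τ) c c' d) dF' →
       dO + dF' ≡ dO' + dF + cardI k (sizeOf τ) c c')
proposition3p7 τ _ k k<ℓ c c' d d≡c =
  ν-faceF , ν-injective , ν-surjective , codim-faceF k<ℓ (sizeOf-beyond≡0 τ)
  where open Isomorphism (length τ) k (sizeOf τ) c c' d d≡c
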